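{- Let $S$ be a numerical semigroup. For all $i,j\ge 2$, we have $\rho\ge|(A_i+A_j)\cap A_{i+j-1}|$.
   Context: A numerical semigroup is a submonoid $S$ of $(\mathbb N,+)$ with $\mathbb N\setminus S$ finite; $m=\min(S\setminus\{0\})$, $c$ is the least $c\in\mathbb N$ with $[c,\infty[\subseteq S$, $q=\lceil c/m\rceil$, and the offset is $\rho=qm-c\in[0,m-1]$. For $j\in\mathbb Z$ let $I_j=[jm-\rho,(j+1)m-\rho-1]$. $A=\{x\in S: x-m\notin S\}$ is the Apéry set with respect to $m$, and $A_i=A\cap I_i$. -}

module Defs where

open import Data.Nat using (ℕ; zero; suc; _+_; _*_; _∸_; _≤_; _<_; _/_; _≡ᵇ_; _<ᵇ_)
open import Data.Bool using (Bool; T; _∧_; _∨_; not)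
open import Data.List using (List; applyUpTo; filterᵇ; concatMap; map; length)
open import Data.Bool.ListAction using (any)
open import Data.Product using (Σ; ∃; _×_)
open import Relation.Nullary using (¬_)

record NumericalSemigroup : Set where
  field
    mem      : ℕ → Bool
    zero∈    : T (mem 0)
    +-closed : ∀ x y → T (mem x) → T (mem y) → T (mem (x + y))
    cofinite : ∃ λ f → ∀ n → f ≤ n → T (mem n)

open NumericalSemigroup public

_∈S_ : ℕ → NumericalSemigroup → Set
x ∈S S = T (mem S x)

IsMultiplicity : NumericalSemigroup → ℕ → Set
IsMultiplicity S m = (0 < m) × (m ∈S S) × (∀ x → 0 < x → x < m → ¬ (x ∈S S))

IsConductor : NumericalSemigroup → ℕ → Set
IsConductor S c =
  (∀ n → c ≤ n → n ∈S S) × (∀ c' → (∀ n → c' ≤ n → n ∈S S) → c ≤ c')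

-- ceiling division ⌈ c / m ⌉ (only used with m ≥ 1)
⌈_/_⌉ : ℕ → ℕ → ℕ
⌈ c / zero ⌉  = 0
⌈ c / suc k ⌉ = (c + k) / suc k

qOf : ℕ → ℕ → ℕ
qOf m c = ⌈ c / m ⌉

ρOf : ℕ → ℕ → ℕ
ρOf m c = qOf m c * m ∸ c

-- I_j = [ j m - ρ , (j+1) m - ρ - 1 ]  (j ≥ 1, so no truncation), as a list
Interval : ℕ → ℕ → ℕ → List ℕ
Interval m c j = applyUpTo (λ t → (j * m ∸ ρOf m c) + t) m

-- x ∈ A  iff  x ∈ S and x - m ∉ S (x - m < 0 counts as ∉ S)
inApéry : NumericalSemigroup → ℕ → ℕ → Bool
inApéry S m x = mem S x ∧ ((x <ᵇ m) ∨ not (mem S (x ∸ m)))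

Apéry : NumericalSemigroup → ℕ → ℕ → ℕ → List ℕ
Apéry S m c i = filterᵇ (inApéry S m) (Interval m c i)

sumset : List ℕ → List ℕ → List ℕ
sumset X Y = concatMap (λ a → map (a +_) Y) X

-- | (A_i + A_j) ∩ A_{i+j-1} |  (A_{i+j-1} has no repetitions, so this is the cardinality)
countSumsInApéry : NumericalSemigroup → ℕ → ℕ → ℕ → ℕ → ℕ
countSumsInApéry S m c i j =
  length (filterᵇ (λ x → any (x ≡ᵇ_) (sumset (Apéry S m c i) (Apéry S m c j)))
                  (Apéry S m c (i + j ∸ 1)))

-- Every element of A_i lies in I_i, hence is at least i m − ρ, so every element of A_i + A_j
-- is at least (i + j) m − 2ρ, which exceeds the left end of I_{i+j−1} by m − ρ. Therefore only
-- the ρ largest of the m elements of I_{i+j−1} can lie in A_i + A_j.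
module Submission where

open import Defs
open import Data.Nat using (ℕ; _≤_; zero; suc; _+_; _*_; _∸_; _<_; _≡ᵇ_; z≤n; s≤s; z<s)
open import Data.Nat.Properties
open import Data.Nat.DivMod using (_/_; m/n*n≤m)
open import Data.Bool using (Bool; T)
open import Data.Bool.ListAction using (any)
open import Data.List using (applyUpTo; filter; filterᵇ; length)
open import Data.List.Properties using (length-applyUpTo; length-filter; filter-reject)
open import Data.List.Relation.Unary.All using (All; lookupAny)
import Data.List.Relation.Unary.All as All
open import Data.List.Relation.Unary.All.Properties using (map⁺; concat⁺; applyUpTo⁺₂; filter⁺)
open import Data.List.Relation.Unary.Any.Properties using (any⁻)
open import Data.List.Relation.Binary.Sublist.Propositional.Properties
  using (filter-⊆; length-mono-≤)
import Data.List.Relation.Binary.Sublist.Propositional.Properties as Sublist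
open import Data.Product using (_,_)
open import Function using (_∘_)
open import Relation.Nullary using (¬_)
open import Relation.Nullary.Decidable using (T?)
open import Relation.Unary using (Decidable)
open import Relation.Binary.PropositionalEquality using (_≡_; refl; sym; cong; subst; module ≡-Reasoning)

length-filter-filter-≤ : ∀ {A : Set} {P Q : A → Set} (P? : Decidable P) (Q? : Decidable Q) xs →
  length (filter P? (filter Q? xs)) ≤ length (filter P? xs)
length-filter-filter-≤ P? Q? xs =
  length-mono-≤ (Sublist.filter⁺ P? P? (λ { refl p → p }) (filter-⊆ Q? xs))

length-filter-applyUpTo-≤ : ∀ {A : Set} {P : A → Set} (P? : Decidable P) (f : ℕ → A) n k →
  (∀ t → t < k → ¬ P (f t)) → length (filter P? (applyUpTo f n)) ≤ n ∸ k
length-filter-applyUpTo-≤ P? f zero k _ = z≤n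
length-filter-applyUpTo-≤ P? f (suc n) zero _ =
  ≤-trans (length-filter P? (applyUpTo f (suc n))) (≤-reflexive (length-applyUpTo f (suc n)))
length-filter-applyUpTo-≤ P? f (suc n) (suc k) prefix-rejected
  rewrite filter-reject P? {xs = applyUpTo (f ∘ suc) n} (prefix-rejected 0 z<s) =
  length-filter-applyUpTo-≤ P? (f ∘ suc) n k (λ t t<k → prefix-rejected (suc t) (s≤s t<k))

sumset-≥ : ∀ {a b X Y} → All (a ≤_) X → All (b ≤_) Y → All (a + b ≤_) (sumset X Y)
sumset-≥ X≥a Y≥b = concat⁺ (map⁺ (All.map (λ a≤x → map⁺ (All.map (+-mono-≤ a≤x) Y≥b)) X≥a))

any-≡ᵇ-≥ : ∀ {b n xs} → All (b ≤_) xs → T (any (n ≡ᵇ_) xs) → b ≤ n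
any-≡ᵇ-≥ {b} {n} {xs} xs≥b n∈xs with lookupAny xs≥b (any⁻ (n ≡ᵇ_) xs n∈xs)
... | b≤x , n≡ᵇx = subst (b ≤_) (sym (≡ᵇ⇒≡ n _ n≡ᵇx)) b≤x

ρOf≤ : ∀ m c → 0 < m → ρOf m c ≤ m
ρOf≤ (suc k) c _ = begin
  (c + k) / suc k * suc k ∸ c  ≤⟨ ∸-monoˡ-≤ c (m/n*n≤m (c + k) (suc k)) ⟩
  c + k ∸ c                    ≡⟨ m+n∸m≡n c k ⟩
  k                            ≤⟨ n≤1+n k ⟩
  suc k                        ∎
  where open ≤-Reasoning

Apéry-≥ : ∀ S m c i → All (i * m ∸ ρOf m c ≤_) (Apéry S m c i)
Apéry-≥ S m c i = filter⁺ (T? ∘ inApéry S m) (applyUpTo⁺₂ _ m (m≤m+n (i * m ∸ ρOf m c)))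

intervalStart-+ : ∀ m ρ i j → ρ ≤ m →
  (i + suc j) * m ∸ ρ + (m ∸ ρ) ≡ suc i * m ∸ ρ + (suc j * m ∸ ρ)
intervalStart-+ m ρ i j ρ≤m = begin
  (i + suc j) * m ∸ ρ + (m ∸ ρ)  ≡⟨ cong (λ z → z ∸ ρ + (m ∸ ρ)) (*-distribʳ-+ m i (suc j)) ⟩
  i * m + Y ∸ ρ + (m ∸ ρ)        ≡⟨ cong (_+ (m ∸ ρ)) (+-∸-assoc (i * m) ρ≤Y) ⟩
  i * m + (Y ∸ ρ) + (m ∸ ρ)      ≡⟨ +-comm (i * m + (Y ∸ ρ)) (m ∸ ρ) ⟩
  (m ∸ ρ) + (i * m + (Y ∸ ρ))    ≡⟨ sym (+-assoc (m ∸ ρ) (i * m) (Y ∸ ρ)) ⟩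
  (m ∸ ρ) + i * m + (Y ∸ ρ)      ≡⟨ cong (_+ (Y ∸ ρ)) (sym (+-∸-comm (i * m) ρ≤m)) ⟩
  m + i * m ∸ ρ + (Y ∸ ρ)        ∎
  where
  open ≡-Reasoning
  Y : ℕ
  Y = suc j * m
  ρ≤Y : ρ ≤ Y
  ρ≤Y = ≤-trans ρ≤m (m≤m+n m (j * m))

corollary2p19 : (S : NumericalSemigroup) (m c : ℕ) → IsMultiplicity S m → IsConductor S c →
    ∀ i j → 2 ≤ i → 2 ≤ j → countSumsInApéry S m c i j ≤ ρOf m c
corollary2p19 S m c (0<m , _) _ (suc i) (suc j) (s≤s _) (s≤s _) = begin
  countSumsInApéry S m c (suc i) (suc j)
    ≤⟨ length-filter-filter-≤ (T? ∘ isSum) (T? ∘ inApéry S m) (Interval m c (i + suc j)) ⟩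
  length (filterᵇ isSum (Interval m c (i + suc j)))
    ≤⟨ length-filter-applyUpTo-≤ (T? ∘ isSum) (base +_) m (m ∸ ρ) no-sum-below ⟩
  m ∸ (m ∸ ρ)
    ≡⟨ m∸[m∸n]≡n ρ≤m ⟩
  ρ ∎
  where
  open ≤-Reasoning
  ρ : ℕ
  ρ = ρOf m c
  ρ≤m : ρ ≤ m
  ρ≤m = ρOf≤ m c 0<m
  base : ℕ
  base = (i + suc j) * m ∸ ρ
  isSum : ℕ → Bool
  isSum x = any (x ≡ᵇ_) (sumset (Apéry S m c (suc i)) (Apéry S m c (suc j)))
  no-sum-below : ∀ t → t < m ∸ ρ → ¬ T (isSum (base + t))
  no-sum-below t t<m∸ρ t-isSum = <⇒≱ (+-monoʳ-< base t<m∸ρ)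
    (subst (_≤ base + t) (sym (intervalStart-+ m ρ i j ρ≤m))
      (any-≡ᵇ-≥ (sumset-≥ (Apéry-≥ S m c (suc i)) (Apéry-≥ S m c (suc j))) t-isSum))
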